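{- If $r,s\ge 2$ with $(r,s)\ne(2,2)$, then $\mathrm{gp}^-(K_r\times K_s)=\min\{r,s,4\}$.
   Context: $K_r\times K_s$ is the direct product: vertex set $V(K_r)\times V(K_s)$, with $(g,h)\sim(g',h')$ iff $g\ne g'$ and $h\ne h'$. A set $S$ of vertices of a connected graph $G$ is a general position set if no shortest path contains three or more vertices of $S$; it is maximal if not properly contained in another general position set; $\mathrm{gp}^-(G)$ is the number of vertices in a smallest maximal general position set. -}

module Defs where

open import Level using (0ℓ)
open import Data.Nat using (ℕ; suc; _<_; _≤_)
open import Data.Fin using (Fin; zero; suc; inject₁) renaming (_<_ to _<ᶠ_)
open import Data.Product using (Σ; ∃; ∃-syntax; _×_; _,_)
open import Data.List using (List; length)
open import Data.List.Membership.Propositional using (_∈_; _∉_)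
open import Data.List.Relation.Unary.Unique.Propositional using (Unique)
open import Relation.Binary.PropositionalEquality using (_≡_; _≢_)
open import Relation.Nullary using (¬_)

record Graph : Set₁ where
  field
    V   : Set
    Adj : V → V → Set

open Graph public

K : ℕ → Graph
K n = record { V = Fin n ; Adj = λ a b → a ≢ b }

_×ᵍ_ : Graph → Graph → Graph
G ×ᵍ H = record
  { V   = V G × V H
  ; Adj = λ { (g , h) (g' , h') → Adj G g g' × Adj H h h' } }

IsWalk : (G : Graph) (k : ℕ) → (Fin (suc k) → V G) → Set
IsWalk G k w = (i : Fin k) → Adj G (w (inject₁ i)) (w (suc i))

WalkFromTo : (G : Graph) (k : ℕ) → V G → V G → (Fin (suc k) → V G) → Set
WalkFromTo G k u v w = IsWalk G k w × w zero ≡ u × w (Data.Fin.fromℕ k) ≡ v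

IsGeodesic : (G : Graph) (k : ℕ) → (Fin (suc k) → V G) → Set
IsGeodesic G k w =
  IsWalk G k w ×
  ((m : ℕ) → m < k → (w' : Fin (suc m) → V G) →
     ¬ WalkFromTo G m (w zero) (w (Data.Fin.fromℕ k)) w')

IsGP : (G : Graph) → List (V G) → Set
IsGP G S =
  (k : ℕ) (w : Fin (suc k) → V G) → IsGeodesic G k w →
  (i j l : Fin (suc k)) → i <ᶠ j → j <ᶠ l →
  ¬ (w i ∈ S × w j ∈ S × w l ∈ S)

_⊆ˢ_ : {A : Set} → List A → List A → Set
S ⊆ˢ T = ∀ {x} → x ∈ S → x ∈ T

IsMaximalGP : (G : Graph) → List (V G) → Set
IsMaximalGP G S =
  IsGP G S × ((T : List (V G)) → IsGP G T → S ⊆ˢ T → T ⊆ˢ S)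

-- gp⁻(G) = m: m is the smallest size of a maximal general position set
-- (sets represented as duplicate-free lists).
IsGpMinus : Graph → ℕ → Set
IsGpMinus G m =
  (Σ (List (V G)) λ S → Unique S × IsMaximalGP G S × length S ≡ m) ×
  ((S : List (V G)) → Unique S → IsMaximalGP G S → m ≤ length S)

-- For r, s ≥ 3 the graph Kᵣ × Kₛ has diameter 2, so a set is in general position
-- exactly when it contains no shortest path u – m – v of length 2. A non-adjacent pair
-- shares a row or a column, and then a vertex of S adjacent to both would be such a
-- middle vertex; hence every general position set of at most two vertices (and, when
-- r, s ≥ 4, of three vertices) lies in a clique, a line or a 2 × 2 box and can be
-- enlarged by a fresh vertex of that clique, line or box. This gives the lower bounds.
-- For the upper bounds, a column of K₃ × Kₛ and a 2 × 2 box of Kᵣ × Kₛ (r, s ≥ 4) are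
-- maximal, since every other vertex is a common neighbour of two non-adjacent members.
-- In K₂ × Kₛ the vertices (0, 0) and (1, 0) are at distance 3 and every other vertex
-- lies on a shortest path between them. The case r > s follows by symmetry.

module Submission where

open import Defs
open import Data.Empty using (⊥; ⊥-elim)
open import Data.Fin as Fin using (Fin; zero; suc; toℕ; fromℕ; _≟_)
open import Data.Fin.Properties using (toℕ-fromℕ; toℕ<n; ¬∀⟶∃¬; pigeonhole)
open import Data.List using (List; []; _∷_; length; map; lookup)
open import Data.List.Properties using (length-map)
open import Data.List.Membership.Propositional.Properties using (∈-map⁺; ∈-map⁻)
open import Data.List.Relation.Unary.Unique.Propositional using (Unique)
import Data.List.Relation.Unary.Unique.Propositional.Properties as Unique
open import Data.List.Membership.Propositional using (_∈_; _∉_)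
open import Data.List.Relation.Unary.All as All using (All; []; _∷_)
open import Data.List.Relation.Unary.All.Properties using (¬Any⇒All¬; All¬⇒¬Any; map⁻)
open import Data.List.Relation.Unary.AllPairs using (AllPairs; []; _∷_)
open import Data.List.Relation.Unary.Any using (here; there; index)
open import Data.List.Relation.Unary.Any.Properties using (lookup-index)
import Data.List.Membership.DecPropositional as DecMembership
open import Data.Nat using (ℕ; zero; suc; _+_; _∸_; _⊓_; _≤_; _<_; z≤n; s≤s; s≤s⁻¹)
open import Data.Nat.Properties
  using (≮⇒≥; <⇒≱; 1+n≰n; +-cancelʳ-≤; m+[n∸m]≡n; +-assoc; +-comm; +-identityʳ; suc-injective;
         ≤-trans; <-trans; ≤-antisym; <-irrefl; n≤1+n; ≤-total; ⊓-zeroʳ; ⊓-commutativeSemigroup; module ≤-Reasoning)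
open import Algebra.Properties.CommutativeSemigroup ⊓-commutativeSemigroup using (x∙yz≈y∙xz)
open import Data.Product using (Σ; ∃; _×_; _,_; proj₁; proj₂; swap; map₂)
open import Data.Sum using (_⊎_; inj₁; inj₂)
open import Relation.Binary.PropositionalEquality
  using (_≡_; _≢_; refl; sym; trans; cong; cong₂; subst; subst₂; ≢-sym; module ≡-Reasoning)
open import Relation.Nullary using (¬_; Dec; yes; no; ¬?; _×-dec_; contradiction)
open import Function using (_∘_; case_of_)

module GeneralPosition (G : Graph) where

  -- Walks as an inductive family, which makes splicing easy; vertex, prefix and suffix
  -- translate between them and the function representation of IsWalk.
  infixr 5 _∷_ _++_

  data Walk : ℕ → V G → V G → Set where
    []  : ∀ {u} → Walk 0 u u
    _∷_ : ∀ {u v w n} → Adj G u v → Walk n v w → Walk (suc n) u w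

  _++_ : ∀ {m n u v w} → Walk m u v → Walk n v w → Walk (m + n) u w
  []       ++ q = q
  (a ∷ p)  ++ q = a ∷ (p ++ q)

  vertex : ∀ {n u v} → Walk n u v → Fin (suc n) → V G
  vertex {u = u} p       zero    = u
  vertex         []      (suc ())
  vertex         (_ ∷ p) (suc i) = vertex p i

  vertex-isWalk : ∀ {n u v} (p : Walk n u v) → IsWalk G n (vertex p)
  vertex-isWalk (a ∷ p) zero    = a
  vertex-isWalk (a ∷ p) (suc i) = vertex-isWalk p i

  vertex-last : ∀ {n u v} (p : Walk n u v) → vertex p (fromℕ n) ≡ v
  vertex-last []      = refl
  vertex-last (a ∷ p) = vertex-last p

  prefix : ∀ {k} (w : Fin (suc k) → V G) → IsWalk G k w → (i : Fin (suc k)) →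
    Walk (toℕ i) (w zero) (w i)
  prefix         w wk zero    = []
  prefix {suc k} w wk (suc i) = wk zero ∷ prefix (w ∘ suc) (wk ∘ suc) i

  suffix : ∀ {k} (w : Fin (suc k) → V G) → IsWalk G k w → (i : Fin (suc k)) →
    Walk (k ∸ toℕ i) (w i) (w (fromℕ k))
  suffix {zero}  w wk zero    = []
  suffix {suc k} w wk zero    = wk zero ∷ suffix (w ∘ suc) (wk ∘ suc) zero
  suffix {suc k} w wk (suc i) = suffix (w ∘ suc) (wk ∘ suc) i

  DistanceAtLeast : ℕ → V G → V G → Set
  DistanceAtLeast k u v = ∀ {m} → Walk m u v → k ≤ m

  geodesic-shortest : ∀ {k w} → IsGeodesic G k w → ∀ {m} → Walk m (w zero) (w (fromℕ k)) → k ≤ m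
  geodesic-shortest (_ , short) {m} p =
    ≮⇒≥ λ m<k → short m m<k (vertex p) (vertex-isWalk p , refl , vertex-last p)

  shortest⇒geodesic : ∀ {k u v} (p : Walk k u v) → DistanceAtLeast k u v →
    IsGeodesic G k (vertex p)
  shortest⇒geodesic p shortest = vertex-isWalk p , λ m m<k w (wk , w₀ , wₘ) →
    <⇒≱ m<k (shortest (subst₂ (Walk m) w₀ (trans wₘ (vertex-last p)) (suffix w wk zero)))

  -- Splicing a walk between positions i and l into the geodesic must not shorten it.
  geodesic-segment : ∀ {k w m} → IsGeodesic G k w → (i l : Fin (suc k)) →
    Walk m (w i) (w l) → toℕ l ≤ toℕ i + m
  geodesic-segment {k} {w} {m} geo@(wk , _) i l p = +-cancelʳ-≤ (k ∸ toℕ l) (toℕ l) (toℕ i + m) (begin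
    toℕ l + (k ∸ toℕ l)        ≡⟨ m+[n∸m]≡n (s≤s⁻¹ (toℕ<n l)) ⟩
    k                          ≤⟨ geodesic-shortest {w = w} geo (prefix w wk i ++ p ++ suffix w wk l) ⟩
    toℕ i + (m + (k ∸ toℕ l))  ≡⟨ +-assoc (toℕ i) m (k ∸ toℕ l) ⟨
    toℕ i + m + (k ∸ toℕ l)    ∎)
    where open ≤-Reasoning

  geodesic-injective : ∀ {k w} → IsGeodesic G k w → (i l : Fin (suc k)) →
    toℕ i < toℕ l → w i ≢ w l
  geodesic-injective {w = w} geo i l i<l wᵢ≡wₗ =
    <⇒≱ i<l (subst (toℕ l ≤_) (+-identityʳ (toℕ i)) (geodesic-segment geo i l (subst (Walk 0 (w i)) wᵢ≡wₗ [])))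

  adjacent-positions : ∀ {k} (w : Fin (suc k) → V G) → IsWalk G k w → (i j : Fin (suc k)) →
    toℕ j ≡ suc (toℕ i) → Adj G (w i) (w j)
  adjacent-positions {suc k} w wk zero    (suc zero)    _ = wk zero
  adjacent-positions {suc k} w wk (suc i) (suc j)       e = adjacent-positions (w ∘ suc) (wk ∘ suc) i j (suc-injective e)
  adjacent-positions {suc k} w wk zero    (suc (suc j)) ()
  adjacent-positions         w wk zero    zero          ()
  adjacent-positions         w wk (suc i) zero          ()

  Between : V G → V G → V G → Set
  Between u y v = Σ ℕ λ k → Σ (Walk k u v) λ p → DistanceAtLeast k u v ×
    Σ (Fin (suc k)) λ j → 0 < toℕ j × toℕ j < k × vertex p j ≡ y

  between-not-GP : ∀ {S u y v} → Between u y v → u ∈ S → y ∈ S → v ∈ S → ¬ IsGP G S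
  between-not-GP {S} (k , p , far , j , 0<j , j<k , refl) u∈S y∈S v∈S gp =
    gp k (vertex p) (shortest⇒geodesic p far) zero j (fromℕ k) 0<j
       (subst (toℕ j <_) (sym (toℕ-fromℕ k)) j<k)
       (u∈S , y∈S , subst (_∈ S) (sym (vertex-last p)) v∈S)

  pair-GP : ∀ {S a b} → (∀ {y} → y ∈ S → y ≡ a ⊎ y ≡ b) → IsGP G S
  pair-GP ⊆ab k w geo i j l i<j j<l (wᵢ∈ , wⱼ∈ , wₗ∈)
    with ⊆ab wᵢ∈ | ⊆ab wⱼ∈ | ⊆ab wₗ∈
  ... | inj₁ refl | inj₁ eq   | _         = geodesic-injective geo i j i<j (sym eq)
  ... | inj₂ refl | inj₂ eq   | _         = geodesic-injective geo i j i<j (sym eq)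
  ... | _         | inj₁ refl | inj₁ eq   = geodesic-injective geo j l j<l (sym eq)
  ... | _         | inj₂ refl | inj₂ eq   = geodesic-injective geo j l j<l (sym eq)
  ... | inj₁ refl | inj₂ refl | inj₁ eq   = geodesic-injective geo i l (<-trans i<j j<l) (sym eq)
  ... | inj₂ refl | inj₁ refl | inj₂ eq   = geodesic-injective geo i l (<-trans i<j j<l) (sym eq)

  Geodesic₂ : V G → V G → V G → Set
  Geodesic₂ u m v = Adj G u m × Adj G m v × u ≢ v × ¬ Adj G u v

  geodesic₂-between : ∀ {u m v} → Geodesic₂ u m v → Between u m v
  geodesic₂-between {u} {m} {v} (um , mv , u≢v , u≁v) =
    2 , um ∷ mv ∷ [] , far , suc zero , s≤s z≤n , s≤s (s≤s z≤n) , refl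
    where
    far : DistanceAtLeast 2 u v
    far []            = ⊥-elim (u≢v refl)
    far (uv ∷ [])     = ⊥-elim (u≁v uv)
    far (_ ∷ _ ∷ _)   = s≤s (s≤s z≤n)

  Geodesic₂Free : (V G → Set) → Set
  Geodesic₂Free P = ∀ {u m v} → P u → P m → P v → ¬ Geodesic₂ u m v

  Diameter≤2 : Set
  Diameter≤2 = ∀ u v → Walk 2 u v

  -- The outer two of the three positions are at distance ≤ 2, so the three are consecutive.
  diameter≤2-GP : Diameter≤2 → ∀ {S} → Geodesic₂Free (_∈ S) → IsGP G S
  diameter≤2-GP diam free k w geo@(wk , _) i j l i<j j<l (wᵢ∈ , wⱼ∈ , wₗ∈) =
    free wᵢ∈ wⱼ∈ wₗ∈
      ( adjacent-positions w wk i j j≡1+i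
      , adjacent-positions w wk j l l≡1+j
      , geodesic-injective geo i l (<-trans i<j j<l)
      , λ a → 1+n≰n (s≤s⁻¹ (subst₂ _≤_ l≡2+i (+-comm (toℕ i) 1) (geodesic-segment geo i l (a ∷ [])))))
    where
    l≤2+i : toℕ l ≤ 2 + toℕ i
    l≤2+i = subst (toℕ l ≤_) (+-comm (toℕ i) 2) (geodesic-segment geo i l (diam (w i) (w l)))
    j≡1+i : toℕ j ≡ suc (toℕ i)
    j≡1+i = ≤-antisym (s≤s⁻¹ (≤-trans j<l l≤2+i)) i<j
    l≡1+j : toℕ l ≡ suc (toℕ j)
    l≡1+j = ≤-antisym (subst (λ n → toℕ l ≤ suc n) (sym j≡1+i) l≤2+i) j<l
    l≡2+i : toℕ l ≡ 2 + toℕ i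
    l≡2+i = trans l≡1+j (cong suc j≡1+i)

  GP⇒geodesic₂Free : ∀ {S} → IsGP G S → Geodesic₂Free (_∈ S)
  GP⇒geodesic₂Free gp u∈S m∈S v∈S g = between-not-GP (geodesic₂-between g) u∈S m∈S v∈S gp

  geodesic₂Free-mono : ∀ {P Q : V G → Set} → (∀ {y} → P y → Q y) → Geodesic₂Free Q → Geodesic₂Free P
  geodesic₂Free-mono P⊆Q free pu pm pv = free (P⊆Q pu) (P⊆Q pm) (P⊆Q pv)

  clique-geodesic₂Free : ∀ {P} → (∀ {u v} → P u → P v → u ≡ v ⊎ Adj G u v) → Geodesic₂Free P
  clique-geodesic₂Free clique pu _ pv (_ , _ , u≢v , u≁v) with clique pu pv
  ... | inj₁ u≡v = u≢v u≡v
  ... | inj₂ u~v = u≁v u~v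

  allPairs-clique : (∀ {u v} → Adj G u v → Adj G v u) → ∀ {T} → AllPairs (Adj G) T →
    ∀ {u v} → u ∈ T → v ∈ T → u ≡ v ⊎ Adj G u v
  allPairs-clique symmetric (_  ∷ _)  (here refl) (here refl) = inj₁ refl
  allPairs-clique symmetric (u~ ∷ _)  (here refl) (there v∈)  = inj₂ (All.lookup u~ v∈)
  allPairs-clique symmetric (v~ ∷ _)  (there u∈)  (here refl) = inj₂ (symmetric (All.lookup v~ u∈))
  allPairs-clique symmetric (_  ∷ ps) (there u∈)  (there v∈)  = allPairs-clique symmetric ps u∈ v∈

  independent-geodesic₂Free : ∀ {P} → (∀ {u v} → P u → P v → ¬ Adj G u v) → Geodesic₂Free P
  independent-geodesic₂Free independent pu pm _ (um , _) = independent pu pm um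

  IntervalsCover : List (V G) → Set
  IntervalsCover S = ∀ y → y ∈ S ⊎ Σ (V G) λ u → Σ (V G) λ v → u ∈ S × v ∈ S × Between u y v

  maximal-GP-criterion : ∀ {S} → IsGP G S → IntervalsCover S → IsMaximalGP G S
  maximal-GP-criterion gp cover = gp , λ T gpT S⊆T {y} y∈T → case cover y of λ where
    (inj₁ y∈S)                    → y∈S
    (inj₂ (u , v , u∈ , v∈ , b)) → ⊥-elim (between-not-GP b (S⊆T u∈) y∈T (S⊆T v∈) gpT)

  extension-not-maximal : ∀ {S x} → x ∉ S → IsGP G (x ∷ S) → ¬ IsMaximalGP G S
  extension-not-maximal x∉S gp (_ , maximal) = x∉S (maximal _ gp there (here refl))

record _≅_ (G H : Graph) : Set where
  field
    to       : V G → V H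
    from     : V H → V G
    to-from  : ∀ y → to (from y) ≡ y
    from-to  : ∀ x → from (to x) ≡ x
    to-adj   : ∀ {x y} → Adj G x y → Adj H (to x) (to y)
    from-adj : ∀ {x y} → Adj H x y → Adj G (from x) (from y)

≅-sym : ∀ {G H} → G ≅ H → H ≅ G
≅-sym iso = record
  { to = from ; from = to ; to-from = from-to ; from-to = to-from ; to-adj = from-adj ; from-adj = to-adj }
  where open _≅_ iso

module _ {G H : Graph} (iso : G ≅ H) where
  open _≅_ iso

  to-injective : ∀ {x y} → to x ≡ to y → x ≡ y
  to-injective {x} {y} eq = trans (sym (from-to x)) (trans (cong from eq) (from-to y))

  ∈-map-to⁻ : ∀ {S y} → y ∈ map to S → from y ∈ S
  ∈-map-to⁻ {S} y∈ with ∈-map⁻ to y∈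
  ... | x , x∈S , refl = subst (_∈ S) (sym (from-to x)) x∈S

  map-to-GP : ∀ {S} → IsGP G S → IsGP H (map to S)
  map-to-GP gp k w (wk , short) i j l i<j j<l (wᵢ∈ , wⱼ∈ , wₗ∈) =
    gp k (from ∘ w) (from-adj ∘ wk , short′) i j l i<j j<l (∈-map-to⁻ wᵢ∈ , ∈-map-to⁻ wⱼ∈ , ∈-map-to⁻ wₗ∈)
    where
    short′ : (m : ℕ) → m < k → (w′ : Fin (suc m) → V G) →
      ¬ WalkFromTo G m (from (w zero)) (from (w (fromℕ k))) w′
    short′ m m<k w′ (wk′ , w′₀ , w′ₘ) = short m m<k (to ∘ w′)
      (to-adj ∘ wk′ , trans (cong to w′₀) (to-from _) , trans (cong to w′ₘ) (to-from _))

map-to-maximal : ∀ {G H} (iso : G ≅ H) {S} → IsMaximalGP G S → IsMaximalGP H (map (_≅_.to iso) S)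
map-to-maximal iso {S} (gp , maximal) = map-to-GP iso gp , λ T gpT S⊆T {y} y∈T →
  subst (_∈ map to S) (to-from y)
    (∈-map⁺ to (maximal (map from T) (map-to-GP (≅-sym iso) gpT)
      (λ {x} x∈S → subst (_∈ map from T) (from-to x) (∈-map⁺ from (S⊆T (∈-map⁺ to x∈S))))
      (∈-map⁺ from y∈T)))
  where open _≅_ iso

≅-gpMinus : ∀ {G H m} → G ≅ H → IsGpMinus G m → IsGpMinus H m
≅-gpMinus {m = m} iso ((S , unique , maximal , |S|≡m) , minimal) =
  (map to S , Unique.map⁺ (to-injective iso) unique , map-to-maximal iso maximal , trans (length-map to S) |S|≡m) ,
  λ T uniqueT maximalT → subst (m ≤_) (length-map from T)
    (minimal (map from T) (Unique.map⁺ (to-injective (≅-sym iso)) uniqueT) (map-to-maximal (≅-sym iso) maximalT))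
  where open _≅_ iso

fresh : ∀ {n} (xs : List (Fin n)) → length xs < n → ∃ λ y → All (y ≢_) xs
fresh {n} xs |xs|<n = map₂ (¬Any⇒All¬ xs) (¬∀⟶∃¬ n (_∈ xs) (_∈? xs) not-surjective)
  where
  open DecMembership _≟_ using (_∈?_)
  not-surjective : ¬ (∀ y → y ∈ xs)
  not-surjective covers with pigeonhole |xs|<n (λ y → index (covers y))
  ... | i , j , i<j , same = <-irrefl (cong toℕ (begin
    i            ≡⟨ lookup-index (covers i) ⟩
    lookup xs _  ≡⟨ cong (lookup xs) same ⟩
    lookup xs _  ≡⟨ lookup-index (covers j) ⟨
    j            ∎)) i<j
    where open ≡-Reasoning

two-valued-≡ : ∀ {A : Set} {a c x y z : A} → x ≡ a ⊎ x ≡ c → y ≡ a ⊎ y ≡ c → z ≡ a ⊎ z ≡ c →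
  x ≢ y → y ≢ z → x ≡ z
two-valued-≡ (inj₁ refl) (inj₁ refl) _           x≢y _   = contradiction refl x≢y
two-valued-≡ (inj₂ refl) (inj₂ refl) _           x≢y _   = contradiction refl x≢y
two-valued-≡ _           (inj₁ refl) (inj₁ refl) _   y≢z = contradiction refl y≢z
two-valued-≡ _           (inj₂ refl) (inj₂ refl) _   y≢z = contradiction refl y≢z
two-valued-≡ (inj₁ refl) (inj₂ refl) (inj₁ refl) _   _   = refl
two-valued-≡ (inj₂ refl) (inj₁ refl) (inj₂ refl) _   _   = refl

module Product (r s : ℕ) where
  open GeneralPosition (K r ×ᵍ K s)

  Vertex : Set
  Vertex = Fin r × Fin s

  adj-sym : ∀ {u v} → Adj (K r ×ᵍ K s) u v → Adj (K r ×ᵍ K s) v u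
  adj-sym (a≢c , b≢d) = ≢-sym a≢c , ≢-sym b≢d

  adjacent? : ∀ u v → Dec (Adj (K r ×ᵍ K s) u v)
  adjacent? (a , b) (c , d) = ¬? (a ≟ c) ×-dec ¬? (b ≟ d)

  diameter≤2 : 3 ≤ r → 3 ≤ s → Diameter≤2
  diameter≤2 3≤r 3≤s (a , b) (c , d) with fresh (a ∷ c ∷ []) 3≤r | fresh (b ∷ d ∷ []) 3≤s
  ... | x , x≢a ∷ x≢c ∷ [] | y , y≢b ∷ y≢d ∷ [] = (≢-sym x≢a , ≢-sym y≢b) ∷ (x≢c , y≢d) ∷ []

  Row : Fin r → Vertex → Set
  Row a y = proj₁ y ≡ a

  Column : Fin s → Vertex → Set
  Column b y = proj₂ y ≡ b

  Box : Fin r → Fin r → Fin s → Fin s → Vertex → Set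
  Box a c b d y = (proj₁ y ≡ a ⊎ proj₁ y ≡ c) × (proj₂ y ≡ b ⊎ proj₂ y ≡ d)

  row-free : ∀ a → Geodesic₂Free (Row a)
  row-free a = independent-geodesic₂Free λ { refl refl (a≢a , _) → a≢a refl }

  column-free : ∀ b → Geodesic₂Free (Column b)
  column-free b = independent-geodesic₂Free λ { refl refl (_ , b≢b) → b≢b refl }

  box-free : ∀ a c b d → Geodesic₂Free (Box a c b d)
  box-free a c b d (u₁ , u₂) (m₁ , m₂) (v₁ , v₂) ((u₁≢m₁ , u₂≢m₂) , (m₁≢v₁ , m₂≢v₂) , u≢v , _) =
    u≢v (cong₂ _,_ (two-valued-≡ u₁ m₁ v₁ u₁≢m₁ m₁≢v₁) (two-valued-≡ u₂ m₂ v₂ u₂≢m₂ m₂≢v₂))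

  row-common-neighbour-between : ∀ {a b b′ y} → b ≢ b′ →
    Adj (K r ×ᵍ K s) (a , b) y → Adj (K r ×ᵍ K s) y (a , b′) → Between (a , b) y (a , b′)
  row-common-neighbour-between b≢b′ u~y y~v =
    geodesic₂-between (u~y , y~v , b≢b′ ∘ cong proj₂ , λ (a≢a , _) → a≢a refl)

  column-common-neighbour-between : ∀ {a a′ b y} → a ≢ a′ →
    Adj (K r ×ᵍ K s) (a , b) y → Adj (K r ×ᵍ K s) y (a′ , b) → Between (a , b) y (a′ , b)
  column-common-neighbour-between a≢a′ u~y y~v =
    geodesic₂-between (u~y , y~v , a≢a′ ∘ cong proj₁ , λ (_ , b≢b) → b≢b refl)

  Extendable : List Vertex → Set
  Extendable T = Σ Vertex λ x → x ∉ T × Geodesic₂Free (_∈ x ∷ T)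

  extendable-not-maximal : Diameter≤2 → ∀ {T} → Extendable T → ¬ IsMaximalGP (K r ×ᵍ K s) T
  extendable-not-maximal diam (x , x∉T , free) = extension-not-maximal x∉T (diameter≤2-GP diam free)

  extendable-⊆ : ∀ {T T′} → T ⊆ˢ T′ → Extendable T′ → Extendable T
  extendable-⊆ T⊆T′ (x , x∉T′ , free) = x , x∉T′ ∘ T⊆T′ , geodesic₂Free-mono
    (λ { (here refl) → here refl ; (there y∈T) → there (T⊆T′ y∈T) }) free

  region-extendable : ∀ {R T x} → Geodesic₂Free R → R x → All R T → All (x ≢_) T → Extendable T
  region-extendable {x = x} free Rx RT x≢T = x , All¬⇒¬Any x≢T , geodesic₂Free-mono
    (λ { (here refl) → Rx ; (there y∈T) → All.lookup RT y∈T }) free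

  row-extendable : ∀ {a T} → All (Row a) T → length T < s → Extendable T
  row-extendable {a} {T} inRow |T|<s with fresh (map proj₂ T) (subst (_< s) (sym (length-map proj₂ T)) |T|<s)
  ... | y , y≢T = region-extendable (row-free a) refl inRow (All.map (_∘ cong proj₂) (map⁻ y≢T))

  column-extendable : ∀ {b T} → All (Column b) T → length T < r → Extendable T
  column-extendable {b} {T} inColumn |T|<r with fresh (map proj₁ T) (subst (_< r) (sym (length-map proj₁ T)) |T|<r)
  ... | x , x≢T = region-extendable (column-free b) refl inColumn (All.map (_∘ cong proj₁) (map⁻ x≢T))

  clique-extendable : ∀ {T} → AllPairs (Adj (K r ×ᵍ K s)) T → length T < r → length T < s → Extendable T
  clique-extendable {T} clique |T|<r |T|<s
    with fresh (map proj₁ T) (subst (_< r) (sym (length-map proj₁ T)) |T|<r)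
       | fresh (map proj₂ T) (subst (_< s) (sym (length-map proj₂ T)) |T|<s)
  ... | x₁ , x₁≢T | x₂ , x₂≢T =
    (x₁ , x₂) , (λ x∈T → proj₁ (All.lookup x~T x∈T) refl) ,
    clique-geodesic₂Free (allPairs-clique adj-sym (x~T ∷ clique))
    where
    x~T : All (Adj (K r ×ᵍ K s) (x₁ , x₂)) T
    x~T = All.zip (map⁻ x₁≢T , map⁻ x₂≢T)

  two-point-extendable : 3 ≤ r → 3 ≤ s → ∀ p q → Extendable (p ∷ q ∷ [])
  two-point-extendable 3≤r 3≤s (a , b) (c , d) with a ≟ c | b ≟ d
  ... | yes refl | _        = row-extendable (refl ∷ refl ∷ []) 3≤s
  ... | no _     | yes refl = column-extendable (refl ∷ refl ∷ []) 3≤r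
  ... | no a≢c   | no b≢d   = clique-extendable (((a≢c , b≢d) ∷ []) ∷ [] ∷ []) 3≤r 3≤s

  nonadjacent-extendable : 4 ≤ r → 4 ≤ s → ∀ {u v c} → u ≢ v → ¬ Adj (K r ×ᵍ K s) u v →
    ¬ (Adj (K r ×ᵍ K s) u c × Adj (K r ×ᵍ K s) c v) → Extendable (u ∷ v ∷ c ∷ [])
  nonadjacent-extendable 4≤r 4≤s {a , b} {a′ , b′} {c₁ , c₂} u≢v u≁v not-between with a ≟ a′ | b ≟ b′
  ... | no a≢a′ | no b≢b′ = contradiction (a≢a′ , b≢b′) u≁v
  ... | yes refl | yes refl = contradiction refl u≢v
  ... | yes refl | no b≢b′ with c₁ ≟ a | c₂ ≟ b | c₂ ≟ b′
  ...   | yes refl | _        | _        = row-extendable (refl ∷ refl ∷ refl ∷ []) 4≤s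
  ...   | no c₁≢a  | yes refl | _        = region-extendable (box-free a c₁ b b′) (inj₂ refl , inj₂ refl)
          ((inj₁ refl , inj₁ refl) ∷ (inj₁ refl , inj₂ refl) ∷ (inj₂ refl , inj₁ refl) ∷ [])
          ((c₁≢a ∘ cong proj₁) ∷ (c₁≢a ∘ cong proj₁) ∷ (≢-sym b≢b′ ∘ cong proj₂) ∷ [])
  ...   | no c₁≢a  | no _     | yes refl = region-extendable (box-free a c₁ b b′) (inj₂ refl , inj₁ refl)
          ((inj₁ refl , inj₁ refl) ∷ (inj₁ refl , inj₂ refl) ∷ (inj₂ refl , inj₂ refl) ∷ [])
          ((c₁≢a ∘ cong proj₁) ∷ (c₁≢a ∘ cong proj₁) ∷ (b≢b′ ∘ cong proj₂) ∷ [])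
  ...   | no c₁≢a  | no c₂≢b  | no c₂≢b′ = contradiction ((≢-sym c₁≢a , ≢-sym c₂≢b) , (c₁≢a , c₂≢b′)) not-between
  nonadjacent-extendable 4≤r 4≤s {a , b} {a′ , b′} {c₁ , c₂} u≢v u≁v not-between | no a≢a′ | yes refl
    with c₂ ≟ b | c₁ ≟ a | c₁ ≟ a′
  ...   | yes refl | _        | _        = column-extendable (refl ∷ refl ∷ refl ∷ []) 4≤r
  ...   | no c₂≢b  | yes refl | _        = region-extendable (box-free a a′ b c₂) (inj₂ refl , inj₂ refl)
          ((inj₁ refl , inj₁ refl) ∷ (inj₂ refl , inj₁ refl) ∷ (inj₁ refl , inj₂ refl) ∷ [])
          ((c₂≢b ∘ cong proj₂) ∷ (c₂≢b ∘ cong proj₂) ∷ (≢-sym a≢a′ ∘ cong proj₁) ∷ [])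
  ...   | no c₂≢b  | no _     | yes refl = region-extendable (box-free a a′ b c₂) (inj₁ refl , inj₂ refl)
          ((inj₁ refl , inj₁ refl) ∷ (inj₂ refl , inj₁ refl) ∷ (inj₂ refl , inj₂ refl) ∷ [])
          ((c₂≢b ∘ cong proj₂) ∷ (c₂≢b ∘ cong proj₂) ∷ (a≢a′ ∘ cong proj₁) ∷ [])
  ...   | no c₂≢b  | no c₁≢a  | no c₁≢a′ = contradiction ((≢-sym c₁≢a , ≢-sym c₂≢b) , (c₁≢a′ , c₂≢b)) not-between

  three-point-extendable : 4 ≤ r → 4 ≤ s → ∀ {p q t} → Unique (p ∷ q ∷ t ∷ []) →
    IsGP (K r ×ᵍ K s) (p ∷ q ∷ t ∷ []) → Extendable (p ∷ q ∷ t ∷ [])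
  three-point-extendable 4≤r 4≤s {p} {q} {t} ((p≢q ∷ p≢t ∷ []) ∷ (q≢t ∷ []) ∷ _) gp =
    by-adjacency (adjacent? p q) (adjacent? p t) (adjacent? q t)
    where
    T : List Vertex
    T = p ∷ q ∷ t ∷ []
    free : Geodesic₂Free (_∈ T)
    free = GP⇒geodesic₂Free gp
    m₀ : p ∈ T
    m₀ = here refl
    m₁ : q ∈ T
    m₁ = there (here refl)
    m₂ : t ∈ T
    m₂ = there (there (here refl))
    by-adjacency : Dec (Adj (K r ×ᵍ K s) p q) → Dec (Adj (K r ×ᵍ K s) p t) → Dec (Adj (K r ×ᵍ K s) q t) →
      Extendable T
    by-adjacency (no p≁q) _ _ = nonadjacent-extendable 4≤r 4≤s p≢q p≁q
      λ (p~t , t~q) → free m₀ m₂ m₁ (p~t , t~q , p≢q , p≁q)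
    by-adjacency (yes _) (no p≁t) _ = extendable-⊆
      (λ { (here refl) → here refl ; (there (here refl)) → there (there (here refl))
         ; (there (there (here refl))) → there (here refl) })
      (nonadjacent-extendable 4≤r 4≤s p≢t p≁t λ (p~q , q~t) → free m₀ m₁ m₂ (p~q , q~t , p≢t , p≁t))
    by-adjacency (yes _) (yes _) (no q≁t) = extendable-⊆
      (λ { (here refl) → there (there (here refl)) ; (there (here refl)) → here refl
         ; (there (there (here refl))) → there (here refl) })
      (nonadjacent-extendable 4≤r 4≤s q≢t q≁t λ (q~p , p~t) → free m₁ m₀ m₂ (q~p , p~t , q≢t , q≁t))
    by-adjacency (yes p~q) (yes p~t) (yes q~t) =
      clique-extendable ((p~q ∷ p~t ∷ []) ∷ (q~t ∷ []) ∷ [] ∷ []) 4≤r 4≤s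

  maximal-size≥2 : 1 ≤ r → 2 ≤ s → ∀ {S} → IsMaximalGP (K r ×ᵍ K s) S → 2 ≤ length S
  maximal-size≥2 1≤r 2≤s {[]} maximal = contradiction maximal
    (extension-not-maximal {x = x} (λ ()) (pair-GP {b = x} λ { (here refl) → inj₁ refl ; (there ()) }))
    where
    x : Vertex
    x = Fin.fromℕ< 1≤r , Fin.fromℕ< (≤-trans (s≤s z≤n) 2≤s)
  maximal-size≥2 1≤r 2≤s {(a , b) ∷ []} maximal with fresh (b ∷ []) 2≤s
  ... | y , y≢b ∷ [] = contradiction maximal (extension-not-maximal {x = a , y}
    (λ { (here a,y≡a,b) → y≢b (cong proj₂ a,y≡a,b) ; (there ()) })
    (pair-GP λ { (here refl) → inj₁ refl ; (there (here refl)) → inj₂ refl ; (there (there ())) }))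
  maximal-size≥2 _ _ {_ ∷ _ ∷ _} _ = s≤s (s≤s z≤n)

  maximal-size≥3 : 3 ≤ r → 3 ≤ s → ∀ {S} → IsMaximalGP (K r ×ᵍ K s) S → 3 ≤ length S
  maximal-size≥3 3≤r 3≤s {S} maximal with maximal-size≥2 (≤-trans (s≤s z≤n) 3≤r) (≤-trans (s≤s (s≤s z≤n)) 3≤s) maximal
  maximal-size≥3 _ _ {_ ∷ []} _ | s≤s ()
  maximal-size≥3 3≤r 3≤s {p ∷ q ∷ []} maximal | _ =
    contradiction maximal (extendable-not-maximal (diameter≤2 3≤r 3≤s) (two-point-extendable 3≤r 3≤s p q))
  maximal-size≥3 _ _ {_ ∷ _ ∷ _ ∷ _} _ | _ = s≤s (s≤s (s≤s z≤n))

  maximal-size≥4 : 4 ≤ r → 4 ≤ s → ∀ {S} → Unique S → IsMaximalGP (K r ×ᵍ K s) S → 4 ≤ length S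
  maximal-size≥4 4≤r 4≤s {S} unique maximal with maximal-size≥3 (≤-trans (n≤1+n 3) 4≤r) (≤-trans (n≤1+n 3) 4≤s) maximal
  maximal-size≥4 _ _ {_ ∷ []} _ _ | s≤s ()
  maximal-size≥4 _ _ {_ ∷ _ ∷ []} _ _ | s≤s (s≤s ())
  maximal-size≥4 4≤r 4≤s {p ∷ q ∷ t ∷ []} unique maximal | _ =
    contradiction maximal (extendable-not-maximal (diameter≤2 (≤-trans (n≤1+n 3) 4≤r) (≤-trans (n≤1+n 3) 4≤s))
      (three-point-extendable 4≤r 4≤s unique (proj₁ maximal)))
  maximal-size≥4 _ _ {_ ∷ _ ∷ _ ∷ _ ∷ _} _ _ | _ = s≤s (s≤s (s≤s (s≤s z≤n)))

Fin2-no-third : ∀ {a a′ m : Fin 2} → a ≢ a′ → a ≢ m → m ≢ a′ → ⊥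
Fin2-no-third {zero}     {zero}     a≢a′ _ _ = a≢a′ refl
Fin2-no-third {suc zero} {suc zero} a≢a′ _ _ = a≢a′ refl
Fin2-no-third {zero}     {suc zero} {zero}     _ a≢m _ = a≢m refl
Fin2-no-third {zero}     {suc zero} {suc zero} _ _ m≢a′ = m≢a′ refl
Fin2-no-third {suc zero} {zero}     {zero}     _ _ m≢a′ = m≢a′ refl
Fin2-no-third {suc zero} {zero}     {suc zero} _ a≢m _ = a≢m refl

module _ (s : ℕ) where
  open GeneralPosition (K 2 ×ᵍ K (3 + s))
  open Product 2 (3 + s)

  K₂-far : ∀ {a a′ b} → a ≢ a′ → DistanceAtLeast 3 (a , b) (a′ , b)
  K₂-far a≢a′ []                                  = contradiction refl a≢a′
  K₂-far a≢a′ ((_ , b≢b) ∷ [])                    = contradiction refl b≢b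
  K₂-far a≢a′ ((a≢m , _) ∷ (m≢a′ , _) ∷ [])       = ⊥-elim (Fin2-no-third a≢a′ a≢m m≢a′)
  K₂-far a≢a′ (_ ∷ _ ∷ _ ∷ _)                     = s≤s (s≤s (s≤s z≤n))

  K₂-between : ∀ {a a′ b b′} → a ≢ a′ → b ≢ b′ → Between (a , b) (a′ , b′) (a′ , b)
  K₂-between {b = b} {b′} a≢a′ b≢b′ with fresh (b ∷ b′ ∷ []) (s≤s (s≤s (s≤s z≤n)))
  ... | c , c≢b ∷ c≢b′ ∷ [] =
    3 , (a≢a′ , b≢b′) ∷ (≢-sym a≢a′ , ≢-sym c≢b′) ∷ (a≢a′ , c≢b) ∷ [] ,
    K₂-far a≢a′ , suc zero , s≤s z≤n , s≤s (s≤s z≤n) , refl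

  gpMinus-K₂×K₃₊ : IsGpMinus (K 2 ×ᵍ K (3 + s)) 2
  gpMinus-K₂×K₃₊ = (S , ((λ ()) ∷ []) ∷ [] ∷ [] , maximal , refl) ,
    λ _ _ → maximal-size≥2 (s≤s z≤n) (s≤s (s≤s z≤n))
    where
    S : List Vertex
    S = (zero , zero) ∷ (suc zero , zero) ∷ []
    cover : IntervalsCover S
    cover (a , b) with b ≟ zero
    cover (zero     , _) | yes refl = inj₁ (here refl)
    cover (suc zero , _) | yes refl = inj₁ (there (here refl))
    cover (zero     , b) | no b≢0   = inj₂ (_ , _ , there (here refl) , here refl , K₂-between (λ ()) (≢-sym b≢0))
    cover (suc zero , b) | no b≢0   = inj₂ (_ , _ , here refl , there (here refl) , K₂-between (λ ()) (≢-sym b≢0))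
    maximal : IsMaximalGP (K 2 ×ᵍ K (3 + s)) S
    maximal = maximal-GP-criterion
      (pair-GP λ { (here refl) → inj₁ refl ; (there (here refl)) → inj₂ refl ; (there (there ())) }) cover

module _ (s : ℕ) where
  open GeneralPosition (K 3 ×ᵍ K (3 + s))
  open Product 3 (3 + s)

  gpMinus-K₃×K₃₊ : IsGpMinus (K 3 ×ᵍ K (3 + s)) 3
  gpMinus-K₃×K₃₊ = (S , ((λ ()) ∷ (λ ()) ∷ []) ∷ ((λ ()) ∷ []) ∷ [] ∷ [] , maximal , refl) ,
    λ _ _ → maximal-size≥3 3≤3 3≤3+s
    where
    3≤3 : 3 ≤ 3
    3≤3 = s≤s (s≤s (s≤s z≤n))
    3≤3+s : 3 ≤ 3 + s
    3≤3+s = s≤s (s≤s (s≤s z≤n))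
    S : List Vertex
    S = (zero , zero) ∷ (suc zero , zero) ∷ (suc (suc zero) , zero) ∷ []
    inColumn : All (Column zero) S
    inColumn = refl ∷ refl ∷ refl ∷ []
    m₀ : (zero , zero) ∈ S
    m₀ = here refl
    m₁ : (suc zero , zero) ∈ S
    m₁ = there (here refl)
    m₂ : (suc (suc zero) , zero) ∈ S
    m₂ = there (there (here refl))
    cover : IntervalsCover S
    cover (a , b) with b ≟ zero
    cover (zero           , _) | yes refl = inj₁ m₀
    cover (suc zero       , _) | yes refl = inj₁ m₁
    cover (suc (suc zero) , _) | yes refl = inj₁ m₂
    cover (zero           , b) | no b≢0   = inj₂ (_ , _ , m₁ , m₂ , column-common-neighbour-between (λ ()) ((λ ()) , ≢-sym b≢0) ((λ ()) , b≢0))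
    cover (suc zero       , b) | no b≢0   = inj₂ (_ , _ , m₀ , m₂ , column-common-neighbour-between (λ ()) ((λ ()) , ≢-sym b≢0) ((λ ()) , b≢0))
    cover (suc (suc zero) , b) | no b≢0   = inj₂ (_ , _ , m₀ , m₁ , column-common-neighbour-between (λ ()) ((λ ()) , ≢-sym b≢0) ((λ ()) , b≢0))
    maximal : IsMaximalGP (K 3 ×ᵍ K (3 + s)) S
    maximal = maximal-GP-criterion
      (diameter≤2-GP (diameter≤2 3≤3 3≤3+s) (geodesic₂Free-mono (All.lookup inColumn) (column-free zero))) cover

module _ (r s : ℕ) where
  open GeneralPosition (K (4 + r) ×ᵍ K (4 + s))
  open Product (4 + r) (4 + s)

  gpMinus-K₄₊×K₄₊ : IsGpMinus (K (4 + r) ×ᵍ K (4 + s)) 4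
  gpMinus-K₄₊×K₄₊ = (S , unique , maximal , refl) , λ _ → maximal-size≥4 4≤ 4≤
    where
    4≤ : ∀ {n} → 4 ≤ 4 + n
    4≤ = s≤s (s≤s (s≤s (s≤s z≤n)))
    3≤ : ∀ {n} → 3 ≤ 4 + n
    3≤ = s≤s (s≤s (s≤s z≤n))
    0₁ 1₁ : ∀ {n} → Fin (2 + n)
    0₁ = zero
    1₁ = suc zero
    S : List Vertex
    S = (0₁ , 0₁) ∷ (0₁ , 1₁) ∷ (1₁ , 0₁) ∷ (1₁ , 1₁) ∷ []
    unique : Unique S
    unique = ((λ ()) ∷ (λ ()) ∷ (λ ()) ∷ []) ∷ ((λ ()) ∷ (λ ()) ∷ []) ∷ ((λ ()) ∷ []) ∷ [] ∷ []
    inBox : All (Box 0₁ 1₁ 0₁ 1₁) S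
    inBox = (inj₁ refl , inj₁ refl) ∷ (inj₁ refl , inj₂ refl) ∷ (inj₂ refl , inj₁ refl) ∷ (inj₂ refl , inj₂ refl) ∷ []
    m₀₀ : (0₁ , 0₁) ∈ S
    m₀₀ = here refl
    m₀₁ : (0₁ , 1₁) ∈ S
    m₀₁ = there (here refl)
    m₁₀ : (1₁ , 0₁) ∈ S
    m₁₀ = there (there (here refl))
    m₁₁ : (1₁ , 1₁) ∈ S
    m₁₁ = there (there (there (here refl)))
    cover : IntervalsCover S
    cover (zero        , zero)        = inj₁ m₀₀
    cover (zero        , suc zero)    = inj₁ m₀₁
    cover (suc zero    , zero)        = inj₁ m₁₀
    cover (suc zero    , suc zero)    = inj₁ m₁₁
    cover (zero        , suc (suc b)) = inj₂ (_ , _ , m₁₀ , m₁₁ , row-common-neighbour-between (λ ())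
        ((λ ()) , (λ ())) ((λ ()) , (λ ())))
    cover (suc zero    , suc (suc b)) = inj₂ (_ , _ , m₀₀ , m₀₁ , row-common-neighbour-between (λ ())
        ((λ ()) , (λ ())) ((λ ()) , (λ ())))
    cover (suc (suc a) , suc (suc b)) = inj₂ (_ , _ , m₀₀ , m₀₁ , row-common-neighbour-between (λ ())
        ((λ ()) , (λ ())) ((λ ()) , (λ ())))
    cover (suc (suc a) , zero)        = inj₂ (_ , _ , m₀₁ , m₁₁ , column-common-neighbour-between (λ ())
        ((λ ()) , (λ ())) ((λ ()) , (λ ())))
    cover (suc (suc a) , suc zero)    = inj₂ (_ , _ , m₀₀ , m₁₀ , column-common-neighbour-between (λ ())
        ((λ ()) , (λ ())) ((λ ()) , (λ ())))
    maximal : IsMaximalGP (K (4 + r) ×ᵍ K (4 + s)) S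
    maximal = maximal-GP-criterion
      (diameter≤2-GP (diameter≤2 3≤ 3≤) (geodesic₂Free-mono (All.lookup inBox) (box-free 0₁ 1₁ 0₁ 1₁))) cover

×ᵍ-swap : ∀ r s → (K r ×ᵍ K s) ≅ (K s ×ᵍ K r)
×ᵍ-swap r s = record
  { to = swap ; from = swap ; to-from = λ _ → refl ; from-to = λ _ → refl ; to-adj = swap ; from-adj = swap }

[4+m]⊓[[4+n]⊓4]≡4 : ∀ m n → (4 + m) ⊓ ((4 + n) ⊓ 4) ≡ 4
[4+m]⊓[[4+n]⊓4]≡4 m n = cong (4 +_) (trans (cong (m ⊓_) (⊓-zeroʳ n)) (⊓-zeroʳ m))

gpMinus-ordered : ∀ r s → 2 ≤ r → r ≤ s → ¬ (r ≡ 2 × s ≡ 2) → IsGpMinus (K r ×ᵍ K s) (r ⊓ (s ⊓ 4))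
gpMinus-ordered 2 2                   _ _ not-2-2 = contradiction (refl , refl) not-2-2
gpMinus-ordered 2 (suc (suc (suc s))) _ _ _       = gpMinus-K₂×K₃₊ s
gpMinus-ordered 3 (suc (suc (suc s))) _ _ _       = gpMinus-K₃×K₃₊ s
gpMinus-ordered (suc (suc (suc (suc r)))) (suc (suc (suc (suc s)))) _ _ _ =
  subst (IsGpMinus (K (4 + r) ×ᵍ K (4 + s))) (sym ([4+m]⊓[[4+n]⊓4]≡4 r s)) (gpMinus-K₄₊×K₄₊ r s)
gpMinus-ordered 3 2 _ (s≤s (s≤s ())) _
gpMinus-ordered (suc (suc (suc (suc _)))) 2 _ (s≤s (s≤s ())) _
gpMinus-ordered (suc (suc (suc (suc _)))) 3 _ (s≤s (s≤s (s≤s ()))) _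
gpMinus-ordered 1 _ (s≤s ()) _ _
gpMinus-ordered (suc (suc _)) 1 _ (s≤s ()) _

theorem5p4 : (r s : ℕ) → 2 ≤ r → 2 ≤ s → ¬ (r ≡ 2 × s ≡ 2) →
    IsGpMinus (K r ×ᵍ K s) (r ⊓ (s ⊓ 4))
theorem5p4 r s 2≤r 2≤s not-2-2 with ≤-total r s
... | inj₁ r≤s = gpMinus-ordered r s 2≤r r≤s not-2-2
... | inj₂ s≤r = subst (IsGpMinus (K r ×ᵍ K s)) (x∙yz≈y∙xz s r 4)
  (≅-gpMinus (×ᵍ-swap s r) (gpMinus-ordered s r 2≤s s≤r (not-2-2 ∘ swap)))
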